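{- Let $G$ be a finite Sylow cyclic group whose order is not divisible by $4$ such that $G=(F\times H)\rtimes R$, where $F\cong\mathrm{F}_{21}$, $R$ is a Sylow $2$-subgroup of $G$, and $F$ and $H$ are normal in $G$. Let $r$ be a generator of $R$, let $S$ be an (inverse-closed) generating set for $G$, let $Y=S\setminus(F\cup(H\rtimes R))$, let $S'=(F\cap S)\cup\{r\}\cup\{s^2\colon s\in Y\}$ and let $\Gamma'=\mathrm{Cay}(F\rtimes R,S')$. If (1) $\Gamma'$ is connected and non-CCA, (2) $Y\subseteq\{fz\colon f\in F,\ z\in Hr,\ |f|=3,\ |z|=2\}$, and (3) if $Y\neq\emptyset$, then $|R|=2$ and $F$ commutes with $R$, then $\mathrm{Cay}(G,S)$ is connected and non-CCA.
   Context: All groups and graphs are finite. For a group $G$ and an inverse-closed subset $S\subseteq G$, $\mathrm{Cay}(G,S)$ is the edge-coloured graph with vertex set $G$ and, for each $g\in G$, $s\in S$, an edge $\{g,sg\}$ of colour $\{s,s^{ -1}\}$. $\mathrm{Aut}_c$ denotes the group of colour-preserving graph automorphisms; $G_R$ is the right regular representation; $\mathrm{Aut}_{\pm1}(G,S)=\{\alpha\in\mathrm{Aut}(G)\colon s^\alpha\in\{s,s^{ -1}\}\ \forall s\in S\}$. $\mathrm{Cay}(G,S)$ is CCA if $\mathrm{Aut}_c(\mathrm{Cay}(G,S))=G_R\rtimes\mathrm{Aut}_{\pm1}(G,S)$, non-CCA otherwise. Sylow cyclic means all Sylow subgroups are cyclic. $\mathrm{F}_{21}$ is the Frobenius group of order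 $21$. -}

module Defs where

open import Level using (0ℓ)
open import Data.Nat using (ℕ; zero; suc; _+_; _*_; _^_; _≤_; _<_)
open import Data.Nat.DivMod using (_mod_)
open import Data.Nat.Divisibility using (_∣_)
open import Data.Nat.Primality using (Prime)
open import Data.Fin using (Fin; toℕ)
open import Data.List using (List; length; filter)
open import Data.List.Membership.Propositional using (_∈_)
open import Data.List.Relation.Unary.Unique.Propositional using (Unique)
open import Data.Product using (Σ; ∃; ∃₂; _×_; _,_)
open import Data.Sum using (_⊎_)
open import Relation.Nullary using (¬_)
open import Relation.Unary using (Decidable)
open import Relation.Binary.PropositionalEquality using (_≡_; _≢_)
open import Algebra.Structures using (IsGroup)
open import Function.Bundles using (_⇔_)

record FinGroup : Set₁ where
  infixl 7 _·_
  infix 8 _⁻¹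
  field
    Carrier        : Set
    _·_            : Carrier → Carrier → Carrier
    e              : Carrier
    _⁻¹            : Carrier → Carrier
    isGroup        : IsGroup _≡_ _·_ e _⁻¹
    elems          : List Carrier
    elems-unique   : Unique elems
    elems-complete : ∀ x → x ∈ elems

module _ (G : FinGroup) where
  open FinGroup G

  order : ℕ
  order = length elems

  pow : Carrier → ℕ → Carrier
  pow x zero    = e
  pow x (suc n) = x · pow x n

  HasOrder : Carrier → ℕ → Set
  HasOrder x n = 1 ≤ n × pow x n ≡ e × (∀ m → 1 ≤ m → m < n → pow x m ≢ e)

  record IsSubgroup (P : Carrier → Set) : Set where
    field
      dec  : Decidable P
      e∈   : P e
      ·∈   : ∀ {x y} → P x → P y → P (x · y)
      ⁻¹∈  : ∀ {x} → P x → P (x ⁻¹)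

  card : {P : Carrier → Set} → IsSubgroup P → ℕ
  card sg = length (filter (IsSubgroup.dec sg) elems)

  IsNormal : (Carrier → Set) → Set
  IsNormal N = ∀ g x → N x → N (g · x · g ⁻¹)

  IsCyclic : (Carrier → Set) → Set
  IsCyclic P = Σ Carrier λ g → P g × (∀ x → P x → ∃ λ n → x ≡ pow g n)

  IsSylow : ℕ → (P : Carrier → Set) → IsSubgroup P → Set
  IsSylow p P sg = ∃ λ k → card sg ≡ p ^ k × ¬ (p ^ suc k ∣ order)

  SylowCyclic : Set₁
  SylowCyclic = ∀ p → Prime p → ∀ (P : Carrier → Set) (sg : IsSubgroup P) →
                IsSylow p P sg → IsCyclic P

  data Gen (S : Carrier → Set) : Carrier → Set where
    gen-e   : Gen S e
    gen-s   : ∀ {s} → S s → Gen S s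
    gen-mul : ∀ {x y} → Gen S x → Gen S y → Gen S (x · y)
    gen-inv : ∀ {x} → Gen S x → Gen S (x ⁻¹)

  Prod : (Carrier → Set) → (Carrier → Set) → Carrier → Set
  Prod A B x = ∃₂ λ a b → A a × B b × x ≡ a · b

  -- Cayley graph Cay(K,S) of a subgroup K (vertex set K), S ⊆ K.
  -- Edges {g, s g} (g ∈ K, s ∈ S) of colour {s, s⁻¹}.
  -- EdgeCol S u v c : {u,v} is an edge of colour {c, c⁻¹}.
  EdgeCol : (Carrier → Set) → Carrier → Carrier → Carrier → Set
  EdgeCol S u v c = (S c ⊎ S (c ⁻¹)) × (v ≡ c · u ⊎ u ≡ c · v)

  BijOn : (Carrier → Set) → (Carrier → Carrier) → Set
  BijOn K φ = (∀ x → K x → K (φ x))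
            × (∀ x y → K x → K y → φ x ≡ φ y → x ≡ y)
            × (∀ y → K y → ∃ λ x → K x × φ x ≡ y)

  ColAut : (Carrier → Set) → (Carrier → Set) → (Carrier → Carrier) → Set
  ColAut K S φ = BijOn K φ
               × (∀ u v c → K u → K v → EdgeCol S u v c ⇔ EdgeCol S (φ u) (φ v) c)

  AutPM : (Carrier → Set) → (Carrier → Set) → (Carrier → Carrier) → Set
  AutPM K S α = BijOn K α
              × (∀ x y → K x → K y → α (x · y) ≡ α x · α y)
              × (∀ s → S s → α s ≡ s ⊎ α s ≡ s ⁻¹)

  -- φ ∈ K_R ⋊ Aut_{±1}(K,S), i.e. φ = (x ↦ x^α g) on K
  InRegAut : (Carrier → Set) → (Carrier → Set) → (Carrier → Carrier) → Set
  InRegAut K S φ = Σ (Carrier → Carrier) λ α → Σ Carrier λ g →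
                   AutPM K S α × K g × (∀ x → K x → φ x ≡ α x · g)

  -- Cay(K,S) is CCA: Aut_c(Cay(K,S)) = K_R ⋊ Aut_{±1}(K,S) (as sets of maps on K)
  IsCCA : (Carrier → Set) → (Carrier → Set) → Set
  IsCCA K S = (∀ φ → ColAut K S φ → InRegAut K S φ)
            × (∀ φ → InRegAut K S φ → ColAut K S φ)

  data Reach (S : Carrier → Set) : Carrier → Set where
    base : Reach S e
    fwd  : ∀ {s x} → S s → Reach S x → Reach S (s · x)
    bwd  : ∀ {s x} → S s → Reach S (s · x) → Reach S x

  Connected : (Carrier → Set) → (Carrier → Set) → Set
  Connected K S = ∀ x → K x → Reach S x

  -- F₂₁ = C₇ ⋊ C₃ on Fin 7 × Fin 3:  (a,b)(c,d) = (a + 2^b c, b + d)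
  F21mul : Fin 7 × Fin 3 → Fin 7 × Fin 3 → Fin 7 × Fin 3
  F21mul (a , b) (c , d) = ((toℕ a + 2 ^ toℕ b * toℕ c) mod 7 , (toℕ b + toℕ d) mod 3)

  IsoF21 : (Carrier → Set) → Set
  IsoF21 F = Σ (Fin 7 × Fin 3 → Carrier) λ ψ →
               (∀ x → F (ψ x))
             × (∀ x y → ψ x ≡ ψ y → x ≡ y)
             × (∀ g → F g → ∃ λ x → ψ x ≡ g)
             × (∀ x y → ψ (F21mul x y) ≡ ψ x · ψ y)

-- Every g ∈ G factors uniquely as g = h x with h ∈ H and x ∈ F R, so a colour-preserving
-- automorphism φ of Γ′ = Cay(F R, S′) extends to ψ (h x) = h φ(x) on Cay(G, S).  A generator in F
-- commutes with H; a generator h ρ ∈ H R acts through ρ, and φ commutes with R because r ∈ S′ is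
-- an involution (4 ∤ |G|); a generator c = f z ∈ Y satisfies c² = f², and the arc of colour c²
-- of Γ′ starting at f r x decides whether ψ maps the c-arc at h x forwards or backwards.
-- If Cay(G, S) were CCA, ψ would be x ↦ α(x) g with α ∈ Aut(G); restricted to F R this makes φ
-- affine with α = ±1 on S′, so Γ′ would be CCA.

module Submission where

open import Defs
open import Algebra.Structures using (IsGroup)
open import Algebra.Bundles using (Group)
import Algebra.Properties.Group as GroupProperties
open import Data.List using (List; []; _∷_; length; filter; map)
open import Data.List.Properties using (length-map; filter-notAll)
open import Data.List.Membership.Propositional using (_∈_)
open import Data.List.Membership.Propositional.Properties
  using (∈-filter⁺; ∈-filter⁻; ∈-map⁺; ∈-map⁻)
open import Data.List.Membership.Propositional.Properties.WithK using (unique∧set⇒bag)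
open import Data.List.Relation.Binary.BagAndSetEquality using (∼bag⇒↭)
open import Data.List.Relation.Binary.Permutation.Propositional.Properties using (↭-length)
open import Data.List.Relation.Unary.Any using (here; there)
open import Data.List.Relation.Unary.Unique.Propositional using (Unique)
import Data.List.Relation.Unary.Unique.Propositional.Properties as Unique
open import Data.Nat using (zero; suc; _+_; _^_; _≤_; _<_; z≤n; s≤s)
open import Data.Nat.Properties using (*-assoc; +-suc; ≤-refl)
open import Data.Nat.Divisibility using (_∣_; _∣0; ∣m∣n⇒∣m+n; ∣-reflexive; ∣-trans; m∣m*n)
open import Data.Nat.Induction using (<-wellFounded)
open import Induction.WellFounded using (Acc; acc)
open import Data.Product using (∃; ∃₂; _×_; _,_; proj₁; proj₂)
open import Data.Sum using (_⊎_; inj₁; inj₂; swap)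
open import Data.Unit using (⊤; tt)
open import Data.Empty using (⊥-elim)
open import Function.Bundles using (_⇔_; mk⇔; Equivalence)
open import Relation.Nullary using (¬_; Dec; yes; no)
open import Relation.Unary using (Decidable)
open import Relation.Unary.Properties using (∁?)
open import Relation.Binary.PropositionalEquality
  using (_≡_; refl; sym; trans; cong; cong₂; subst; subst₂; module ≡-Reasoning)

length≡filter+filter-∁ : ∀ {A : Set} {P : A → Set} (P? : Decidable P) xs →
                        length xs ≡ length (filter P? xs) + length (filter (∁? P?) xs)
length≡filter+filter-∁ P? [] = refl
length≡filter+filter-∁ P? (x ∷ xs) with P? x
... | yes _ = cong suc (length≡filter+filter-∁ P? xs)
... | no _  = trans (cong suc (length≡filter+filter-∁ P? xs)) (sym (+-suc _ _))

three-members-of-pair : ∀ {A : Set} {xs : List A} {a b c : A} → length xs ≤ 2 →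
                        a ∈ xs → b ∈ xs → c ∈ xs → a ≡ b ⊎ a ≡ c ⊎ b ≡ c
three-members-of-pair {xs = _ ∷ _ ∷ _ ∷ _} (s≤s (s≤s ()))
three-members-of-pair _ (here refl)         (here refl)         _                   = inj₁ refl
three-members-of-pair _ (there (here refl)) (there (here refl)) _                   = inj₁ refl
three-members-of-pair _ (here refl)         (there (here refl)) (here refl)         = inj₂ (inj₁ refl)
three-members-of-pair _ (here refl)         (there (here refl)) (there (here refl)) = inj₂ (inj₂ refl)
three-members-of-pair _ (there (here refl)) (here refl)         (here refl)         = inj₂ (inj₂ refl)
three-members-of-pair _ (there (here refl)) (here refl)         (there (here refl)) = inj₂ (inj₁ refl)

2^k∣n∧4∤n⇒2^k≤2 : ∀ {n} k → 2 ^ k ∣ n → ¬ 4 ∣ n → 2 ^ k ≤ 2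
2^k∣n∧4∤n⇒2^k≤2 zero          _ _   = s≤s z≤n
2^k∣n∧4∤n⇒2^k≤2 (suc zero)    _ _   = ≤-refl
2^k∣n∧4∤n⇒2^k≤2 (suc (suc k)) d 4∤n =
  ⊥-elim (4∤n (∣-trans (subst (4 ∣_) (*-assoc 2 2 (2 ^ k)) (m∣m*n (2 ^ k))) d))

module _ (G : FinGroup) where
  open FinGroup G

  group : Group _ _
  group = record { isGroup = isGroup }

  open IsGroup isGroup using (assoc; identityˡ; identityʳ; inverseˡ; inverseʳ)
  open GroupProperties group
  open ≡-Reasoning

  ·-·⁻¹-cancel : ∀ a b c → a · b · (c · b) ⁻¹ ≡ a · c ⁻¹
  ·-·⁻¹-cancel a b c = begin
    a · b · (c · b) ⁻¹     ≡⟨ cong (a · b ·_) (⁻¹-anti-homo-∙ c b) ⟩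
    a · b · (b ⁻¹ · c ⁻¹)  ≡⟨ assoc a b _ ⟩
    a · (b · (b ⁻¹ · c ⁻¹)) ≡⟨ cong (a ·_) (\\-leftDividesˡ b (c ⁻¹)) ⟩
    a · c ⁻¹               ∎

  -- Lagrange's theorem
  module _ {P : Carrier → Set} (sg : IsSubgroup G P) where
    open IsSubgroup sg

    length-coset : ∀ {x xs} → Unique xs → (∀ {y} → y ∈ xs ⇔ P (x ⁻¹ · y)) → length xs ≡ card G sg
    length-coset {x} {xs} xs! xs≡xP = begin
      length xs  ≡⟨ ↭-length (∼bag⇒↭ (unique∧set⇒bag xs! xP! (λ {y} → xs∼xP))) ⟩
      length xP  ≡⟨ length-map (x ·_) (filter dec elems) ⟩
      card G sg  ∎
      where
      xP : List Carrier
      xP = map (x ·_) (filter dec elems)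
      xP! : Unique xP
      xP! = Unique.map⁺ (∙-cancelˡ x _ _) (Unique.filter⁺ dec elems-unique)
      ∈xP⇔ : ∀ {y} → y ∈ xP ⇔ P (x ⁻¹ · y)
      ∈xP⇔ {y} = mk⇔ to from
        where
        to : y ∈ xP → P (x ⁻¹ · y)
        to y∈ with ∈-map⁻ (x ·_) y∈
        ... | p , p∈ , refl = subst P (sym (\\-leftDividesʳ x p)) (proj₂ (∈-filter⁻ dec {xs = elems} p∈))
        from : P (x ⁻¹ · y) → y ∈ xP
        from p = subst (_∈ xP) (\\-leftDividesˡ x y)
                   (∈-map⁺ (x ·_) (∈-filter⁺ dec (elems-complete (x ⁻¹ · y)) p))
      xs∼xP : ∀ {y} → y ∈ xs ⇔ y ∈ xP
      xs∼xP = mk⇔ (λ y∈ → Equivalence.from ∈xP⇔ (Equivalence.to xs≡xP y∈))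
                       (λ y∈ → Equivalence.from xs≡xP (Equivalence.to ∈xP⇔ y∈))

    card∣length-of-coset-union : ∀ xs → Acc _<_ (length xs) → Unique xs →
                                 (∀ {y z} → y ∈ xs → P (y ⁻¹ · z) → z ∈ xs) → card G sg ∣ length xs
    card∣length-of-coset-union []         _         _   _      = _ ∣0
    card∣length-of-coset-union xs@(x ∷ _) (acc rec) xs! closed =
      subst (card G sg ∣_) (sym (length≡filter+filter-∁ xP? xs))
        (∣m∣n⇒∣m+n (∣-reflexive (sym (length-coset (Unique.filter⁺ xP? xs!) ∈xP⇔)))
                   (card∣length-of-coset-union rest (rec shorter) (Unique.filter⁺ (∁? xP?) xs!) rest-closed))
      where
      xP? : Decidable (λ y → P (x ⁻¹ · y))
      xP? y = dec (x ⁻¹ · y)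
      rest : List Carrier
      rest = filter (∁? xP?) xs
      ∈xP⇔ : ∀ {y} → y ∈ filter xP? xs ⇔ P (x ⁻¹ · y)
      ∈xP⇔ = mk⇔ (λ y∈ → proj₂ (∈-filter⁻ xP? {xs = xs} y∈))
                 (λ p → ∈-filter⁺ xP? (closed (here refl) p) p)
      shorter : length rest < length xs
      shorter = filter-notAll (∁? xP?) xs (here λ x∉xP → x∉xP (subst P (sym (inverseˡ x)) e∈))
      rest-closed : ∀ {y z} → y ∈ rest → P (y ⁻¹ · z) → z ∈ rest
      rest-closed {y} {z} y∈ p with ∈-filter⁻ (∁? xP?) {xs = xs} y∈
      ... | y∈xs , y∉xP = ∈-filter⁺ (∁? xP?) (closed y∈xs p)
                            λ q → y∉xP (subst P quotient≡ (·∈ q (⁻¹∈ p)))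
        where
        quotient≡ : x ⁻¹ · z · (y ⁻¹ · z) ⁻¹ ≡ x ⁻¹ · y
        quotient≡ = trans (·-·⁻¹-cancel (x ⁻¹) z (y ⁻¹)) (cong (x ⁻¹ ·_) (⁻¹-involutive y))

    card∣order : card G sg ∣ order G
    card∣order = card∣length-of-coset-union elems (<-wellFounded _) elems-unique
                   (λ {_} {z} _ _ → elems-complete z)

  square≡e-in-Sylow₂ : ∀ {R} (sR : IsSubgroup G R) → IsSylow G 2 R sR → ¬ 4 ∣ order G →
                       ∀ {r} → R r → r · r ≡ e
  square≡e-in-Sylow₂ {R} sR (k , |R|≡2^k , _) 4∤|G| {r} Rr =
    square≡e (three-members-of-pair |R|≤2 (mem e∈) (mem Rr) (mem (·∈ Rr Rr)))
    where
    open IsSubgroup sR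
    mem : ∀ {x} → R x → x ∈ filter dec elems
    mem {x} Rx = ∈-filter⁺ dec (elems-complete x) Rx
    |R|≤2 : card G sR ≤ 2
    |R|≤2 = subst (_≤ 2) (sym |R|≡2^k)
              (2^k∣n∧4∤n⇒2^k≤2 k (subst (_∣ order G) |R|≡2^k (card∣order sR)) 4∤|G|)
    square≡e : e ≡ r ⊎ e ≡ r · r ⊎ r ≡ r · r → r · r ≡ e
    square≡e (inj₁ refl)        = identityˡ e
    square≡e (inj₂ (inj₁ e≡r²)) = sym e≡r²
    square≡e (inj₂ (inj₂ r≡r²)) = trans (sym r≡r²) (identityʳ-unique r r (sym r≡r²))

  conj-shift : ∀ a ρ h v → a · (ρ · h · ρ ⁻¹) · (ρ · v) ≡ a · ρ · (h · v)
  conj-shift a ρ h v = begin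
    a · (ρ · h · ρ ⁻¹) · (ρ · v)    ≡⟨ assoc a _ _ ⟩
    a · (ρ · h · ρ ⁻¹ · (ρ · v))    ≡⟨ cong (a ·_) (assoc (ρ · h) _ _) ⟩
    a · (ρ · h · (ρ ⁻¹ · (ρ · v)))  ≡⟨ cong (λ w → a · (ρ · h · w)) (\\-leftDividesʳ ρ v) ⟩
    a · (ρ · h · v)                 ≡⟨ cong (a ·_) (assoc ρ h v) ⟩
    a · (ρ · (h · v))               ≡⟨ assoc a ρ _ ⟨
    a · ρ · (h · v)                 ∎

  disjoint-normal-commute : ∀ {N M} → IsSubgroup G N → IsSubgroup G M → IsNormal G N → IsNormal G M →
                            (∀ x → N x → M x → x ≡ e) → ∀ {a b} → N a → M b → a · b ≡ b · a
  disjoint-normal-commute {N} {M} sN sM nN nM N∩M {a} {b} Na Mb = begin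
    a · b                ≡⟨ //-rightDividesˡ a (a · b) ⟨
    a · b · a ⁻¹ · a     ≡⟨ cong (_· a) (x∙y⁻¹≈ε⇒x≈y _ b (N∩M _ N[aba⁻¹b⁻¹] M[aba⁻¹b⁻¹])) ⟩
    b · a                ∎
    where
    module N = IsSubgroup sN
    module M = IsSubgroup sM
    M[aba⁻¹b⁻¹] : M (a · b · a ⁻¹ · b ⁻¹)
    M[aba⁻¹b⁻¹] = M.·∈ (nM a b Mb) (M.⁻¹∈ Mb)
    N[aba⁻¹b⁻¹] : N (a · b · a ⁻¹ · b ⁻¹)
    N[aba⁻¹b⁻¹] = subst N (trans (sym (assoc a _ _)) (cong (_· b ⁻¹) (sym (assoc a b _))))
                    (N.·∈ Na (nN b (a ⁻¹) (N.⁻¹∈ Na)))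

  record ClosedUnderGroupOps (K : Carrier → Set) : Set where
    field
      e∈  : K e
      ·∈  : ∀ {x y} → K x → K y → K (x · y)
      ⁻¹∈ : ∀ {x} → K x → K (x ⁻¹)

  IsSubgroup⇒Closed : ∀ {K} → IsSubgroup G K → ClosedUnderGroupOps K
  IsSubgroup⇒Closed sK = record { e∈ = e∈ ; ·∈ = ·∈ ; ⁻¹∈ = ⁻¹∈ } where open IsSubgroup sK

  normal·subgroup-closed : ∀ {N K} → IsSubgroup G N → IsNormal G N → IsSubgroup G K →
                           ClosedUnderGroupOps (Prod G N K)
  normal·subgroup-closed {N} {K} sN nN sK = record
    { e∈  = e , e , N.e∈ , K.e∈ , sym (identityˡ e)
    ; ·∈  = λ { (a , ρ , Na , Kρ , refl) (b , σ , Nb , Kσ , refl) →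
                a · (ρ · b · ρ ⁻¹) , ρ · σ , N.·∈ Na (nN ρ b Nb) , K.·∈ Kρ Kσ , sym (conj-shift a ρ b σ) }
    ; ⁻¹∈ = λ { (a , ρ , Na , Kρ , refl) →
                ρ ⁻¹ · a ⁻¹ · ρ ⁻¹ ⁻¹ , ρ ⁻¹ , nN (ρ ⁻¹) (a ⁻¹) (N.⁻¹∈ Na) , K.⁻¹∈ Kρ ,
                trans (⁻¹-anti-homo-∙ a ρ) (sym (//-rightDividesˡ (ρ ⁻¹) _)) }
    }
    where
    module N = IsSubgroup sN
    module K = IsSubgroup sK

  -- Cayley graphs
  Joined : Carrier → Carrier → Carrier → Set
  Joined c u v = v ≡ c · u ⊎ u ≡ c · v

  PreservesArcs : (Carrier → Set) → (Carrier → Set) → (Carrier → Carrier) → Set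
  PreservesArcs K S φ = ∀ {c x} → S c → K x → Joined c (φ x) (φ (c · x))

  Reach-· : ∀ {S x y} → Reach G S x → Reach G S y → Reach G S (x · y)
  Reach-· {S} {y = y} base            ry = subst (Reach G S) (sym (identityˡ y)) ry
  Reach-· {S} {y = y} (fwd {s} Ss rx) ry = subst (Reach G S) (sym (assoc s _ y)) (fwd Ss (Reach-· rx ry))
  Reach-· {S} {y = y} (bwd {s} Ss rx) ry = bwd Ss (subst (Reach G S) (assoc s _ y) (Reach-· rx ry))

  Reach-gen : ∀ {S s} → S s → Reach G S s
  Reach-gen {S} {s} Ss = subst (Reach G S) (identityʳ s) (fwd Ss base)

  Joined-involution : ∀ {c u v} → c · c ≡ e → Joined c u v → v ≡ c · u
  Joined-involution             _    (inj₁ v≡cu) = v≡cu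
  Joined-involution {c} {v = v} c²≡e (inj₂ refl) = sym (begin
    c · (c · v)  ≡⟨ assoc c c v ⟨
    c · c · v    ≡⟨ cong (_· v) c²≡e ⟩
    e · v        ≡⟨ identityˡ v ⟩
    v            ∎)

  Joined-·ˡ : ∀ {c h u v} → (∀ w → c · (h · w) ≡ h · (c · w)) → Joined c u v → Joined c (h · u) (h · v)
  Joined-·ˡ ch≡hc (inj₁ refl) = inj₁ (sym (ch≡hc _))
  Joined-·ˡ ch≡hc (inj₂ refl) = inj₂ (sym (ch≡hc _))

  module _ {K S : Carrier → Set} (K-closed : ClosedUnderGroupOps K) (S⊆K : ∀ {s} → S s → K s) where
    open ClosedUnderGroupOps K-closed

    ColAut⇒PreservesArcs : ∀ {φ} → ColAut G K S φ → PreservesArcs K S φ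
    ColAut⇒PreservesArcs (_ , edges) {c} {x} Sc Kx =
      proj₂ (Equivalence.to (edges x (c · x) c Kx (·∈ (S⊆K Sc) Kx)) (inj₁ Sc , inj₁ refl))

    ColAut⇒section-PreservesArcs : ∀ {φ θ} → ColAut G K S φ → (∀ {x} → K x → K (θ x)) →
                                   (∀ {x} → K x → φ (θ x) ≡ x) → PreservesArcs K S θ
    ColAut⇒section-PreservesArcs {φ} {θ} (_ , edges) θ∈ φθ {c} {x} Sc Kx =
      proj₂ (Equivalence.from (edges (θ x) (θ (c · x)) c (θ∈ Kx) (θ∈ Kcx))
              (inj₁ Sc , inj₁ (trans (φθ Kcx) (cong (c ·_) (sym (φθ Kx))))))
      where
      Kcx : K (c · x)
      Kcx = ·∈ (S⊆K Sc) Kx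

  module _ {S : Carrier → Set} (S⁻¹ : ∀ s → S s → S (s ⁻¹)) where

    colour⇒S : ∀ {c} → S c ⊎ S (c ⁻¹) → S c
    colour⇒S (inj₁ Sc)         = Sc
    colour⇒S {c} (inj₂ Sc⁻¹) = subst S (⁻¹-involutive c) (S⁻¹ _ Sc⁻¹)

    PreservesArcs⇒Joined : ∀ {φ} → PreservesArcs (λ _ → ⊤) S φ →
                           ∀ {c u v} → S c → Joined c u v → Joined c (φ u) (φ v)
    PreservesArcs⇒Joined arcs         Sc (inj₁ refl) = arcs Sc tt
    PreservesArcs⇒Joined arcs {v = v} Sc (inj₂ refl) = swap (arcs {x = v} Sc tt)

    inverses⇒ColAut : ∀ {φ θ} → (∀ x → θ (φ x) ≡ x) → (∀ x → φ (θ x) ≡ x) →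
                      PreservesArcs (λ _ → ⊤) S φ → PreservesArcs (λ _ → ⊤) S θ →
                      ColAut G (λ _ → ⊤) S φ
    inverses⇒ColAut {φ} {θ} θφ φθ φ-arcs θ-arcs =
      ((λ _ _ → tt) , (λ x y _ _ φx≡φy → trans (sym (θφ x)) (trans (cong θ φx≡φy) (θφ y))) ,
       (λ y _ → θ y , tt , φθ y)) ,
      λ u v c _ _ → mk⇔
        (λ (col , uv) → col , PreservesArcs⇒Joined {φ} φ-arcs (colour⇒S col) uv)
        (λ (col , uv) → col , subst₂ (Joined c) (θφ u) (θφ v) (PreservesArcs⇒Joined {θ} θ-arcs (colour⇒S col) uv))

    Reach-⁻¹ : ∀ {x} → Reach G S x → Reach G S (x ⁻¹)
    Reach-⁻¹ base = subst (Reach G S) (sym ε⁻¹≈ε) base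
    Reach-⁻¹ (fwd {s} {x} Ss rx) =
      subst (Reach G S) (sym (⁻¹-anti-homo-∙ s x)) (Reach-· (Reach-⁻¹ rx) (Reach-gen (S⁻¹ s Ss)))
    Reach-⁻¹ (bwd {s} {x} Ss rx) =
      subst (Reach G S) (trans (cong (_· s) (⁻¹-anti-homo-∙ s x)) (//-rightDividesˡ s (x ⁻¹)))
        (Reach-· (Reach-⁻¹ rx) (Reach-gen Ss))

    Gen⇒Reach : ∀ {x} → Gen G S x → Reach G S x
    Gen⇒Reach gen-e         = base
    Gen⇒Reach (gen-s Ss)    = Reach-gen Ss
    Gen⇒Reach (gen-mul a b) = Reach-· (Gen⇒Reach a) (Gen⇒Reach b)
    Gen⇒Reach (gen-inv a)   = Reach-⁻¹ (Gen⇒Reach a)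

  module Affine {K S : Carrier → Set} (K-closed : ClosedUnderGroupOps K) (S⊆K : ∀ {s} → S s → K s)
                {φ α : Carrier → Carrier} {g : Carrier}
                (α-hom : ∀ x y → K x → K y → α (x · y) ≡ α x · α y)
                (φ≡αg : ∀ x → K x → φ x ≡ α x · g) where
    open ClosedUnderGroupOps K-closed

    α-e : α e ≡ e
    α-e = identityʳ-unique (α e) (α e) (trans (sym (α-hom e e e∈ e∈)) (cong α (identityˡ e)))

    φ-e : φ e ≡ g
    φ-e = trans (φ≡αg e e∈) (trans (cong (_· g) α-e) (identityˡ g))

    φ-· : ∀ {c x} → K c → K x → φ (c · x) ≡ α c · φ x
    φ-· {c} {x} Kc Kx = begin
      φ (c · x)        ≡⟨ φ≡αg _ (·∈ Kc Kx) ⟩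
      α (c · x) · g    ≡⟨ cong (_· g) (α-hom c x Kc Kx) ⟩
      α c · α x · g    ≡⟨ assoc _ _ _ ⟩
      α c · (α x · g)  ≡⟨ cong (α c ·_) (φ≡αg x Kx) ⟨
      α c · φ x        ∎

    α-⁻¹ : ∀ {c} → K c → α (c ⁻¹) ≡ α c ⁻¹
    α-⁻¹ {c} Kc = inverseʳ-unique (α c) (α (c ⁻¹))
                    (trans (sym (α-hom c (c ⁻¹) Kc (⁻¹∈ Kc))) (trans (cong α (inverseʳ c)) α-e))

    Signed : Carrier → Set
    Signed c = α c ≡ c ⊎ α c ≡ c ⁻¹

    ColAut⇒Signed : ColAut G K S φ → ∀ {s} → S s → Signed s
    ColAut⇒Signed col {s} Ss with ColAut⇒PreservesArcs K-closed S⊆K col Ss e∈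
    ... | inj₁ φs≡sφe = inj₁ (∙-cancelʳ (φ e) (α s) s (trans (sym (φ-· (S⊆K Ss) e∈)) φs≡sφe))
    ... | inj₂ φe≡sφs = inj₂ (inverseʳ-unique s (α s) (identityˡ-unique (s · α s) (φ e) (begin
      s · α s · φ e    ≡⟨ assoc s _ _ ⟩
      s · (α s · φ e)  ≡⟨ cong (s ·_) (φ-· (S⊆K Ss) e∈) ⟨
      s · φ (s · e)    ≡⟨ φe≡sφs ⟨
      φ e              ∎)))

    ColAut⇒InRegAut : (∀ x y → K x → K y → α x ≡ α y → x ≡ y) → ColAut G K S φ → InRegAut G K S φ
    ColAut⇒InRegAut α-inj col@((φ∈ , _ , φ-surj) , _) =
      α , g , ((α∈ , α-inj , α-surj) , α-hom , λ _ → ColAut⇒Signed col) , Kg , φ≡αg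
      where
      Kg : K g
      Kg = subst K φ-e (φ∈ e e∈)
      α∈ : ∀ x → K x → K (α x)
      α∈ x Kx = subst K (sym (x≈z//y (α x) g (φ x) (sym (φ≡αg x Kx)))) (·∈ (φ∈ x Kx) (⁻¹∈ Kg))
      α-surj : ∀ y → K y → ∃ λ x → K x × α x ≡ y
      α-surj y Ky with φ-surj (y · g) (·∈ Ky Kg)
      ... | x , Kx , φx≡yg = x , Kx , ∙-cancelʳ g (α x) y (trans (sym (φ≡αg x Kx)) φx≡yg)

    colour⇒Signed : (∀ {s} → S s → Signed s) → ∀ {c} → S c ⊎ S (c ⁻¹) → K c × Signed c
    colour⇒Signed ±S (inj₁ Sc)         = S⊆K Sc , ±S Sc
    colour⇒Signed ±S {c} (inj₂ Sc⁻¹) = Kc , flip (±S Sc⁻¹)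
      where
      Kc : K c
      Kc = subst K (⁻¹-involutive c) (⁻¹∈ (S⊆K Sc⁻¹))
      flip : Signed (c ⁻¹) → Signed c
      flip (inj₁ α[c⁻¹]≡c⁻¹) = inj₁ (⁻¹-injective (trans (sym (α-⁻¹ Kc)) α[c⁻¹]≡c⁻¹))
      flip (inj₂ α[c⁻¹]≡c)   = inj₂ (⁻¹-injective (trans (sym (α-⁻¹ Kc)) α[c⁻¹]≡c))

    module _ (α-inj : ∀ x y → K x → K y → α x ≡ α y → x ≡ y) where

      φ-injective : ∀ {x y} → K x → K y → φ x ≡ φ y → x ≡ y
      φ-injective {x} {y} Kx Ky φx≡φy =
        α-inj x y Kx Ky (∙-cancelʳ g _ _ (trans (sym (φ≡αg x Kx)) (trans φx≡φy (φ≡αg y Ky))))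

      arc⇒Joined-φ : ∀ {c x} → K c → Signed c → K x → Joined c (φ x) (φ (c · x))
      arc⇒Joined-φ {c} {x} Kc (inj₁ αc≡c)   Kx = inj₁ (trans (φ-· Kc Kx) (cong (_· φ x) αc≡c))
      arc⇒Joined-φ {c} {x} Kc (inj₂ αc≡c⁻¹) Kx = inj₂ (begin
        φ x                  ≡⟨ \\-leftDividesˡ c (φ x) ⟨
        c · (c ⁻¹ · φ x)     ≡⟨ cong (λ w → c · (w · φ x)) αc≡c⁻¹ ⟨
        c · (α c · φ x)      ≡⟨ cong (c ·_) (φ-· Kc Kx) ⟨
        c · φ (c · x)        ∎)

      φ-arc⇒Joined : ∀ {c u v} → K c → Signed c → K u → K v → φ v ≡ c · φ u → Joined c u v
      φ-arc⇒Joined {c} {u} {v} Kc (inj₁ αc≡c) Ku Kv φv≡cφu =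
        inj₁ (φ-injective Kv (·∈ Kc Ku) (trans φv≡cφu (sym (trans (φ-· Kc Ku) (cong (_· φ u) αc≡c)))))
      φ-arc⇒Joined {c} {u} {v} Kc (inj₂ αc≡c⁻¹) Ku Kv φv≡cφu =
        inj₂ (φ-injective Ku (·∈ Kc Kv) (sym (begin
          φ (c · v)          ≡⟨ φ-· Kc Kv ⟩
          α c · φ v          ≡⟨ cong₂ _·_ αc≡c⁻¹ φv≡cφu ⟩
          c ⁻¹ · (c · φ u)   ≡⟨ \\-leftDividesʳ c (φ u) ⟩
          φ u                ∎)))

      Joined⇔Joined-φ : ∀ {c u v} → K c → Signed c → K u → K v → Joined c u v ⇔ Joined c (φ u) (φ v)
      Joined⇔Joined-φ Kc ±c Ku Kv = mk⇔
        (λ { (inj₁ refl) → arc⇒Joined-φ Kc ±c Ku ; (inj₂ refl) → swap (arc⇒Joined-φ Kc ±c Kv) })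
        (λ { (inj₁ φv≡cφu) → φ-arc⇒Joined Kc ±c Ku Kv φv≡cφu
           ; (inj₂ φu≡cφv) → swap (φ-arc⇒Joined Kc ±c Kv Ku φu≡cφv) })

  InRegAut⇒ColAut : ∀ {K S φ} → ClosedUnderGroupOps K → (∀ {s} → S s → K s) →
                    InRegAut G K S φ → ColAut G K S φ
  InRegAut⇒ColAut {K} {S} {φ} K-closed S⊆K (α , g , ((α∈ , α-inj , α-surj) , α-hom , α-±1) , Kg , φ≡αg) =
    (φ∈ , (λ _ _ → φ-injective α-inj) , φ-surj) ,
    λ u v c Ku Kv → mk⇔
      (λ (col , uv) → col , Equivalence.to   (Joined⇔ col Ku Kv) uv)
      (λ (col , uv) → col , Equivalence.from (Joined⇔ col Ku Kv) uv)
    where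
    open ClosedUnderGroupOps K-closed
    open Affine K-closed S⊆K α-hom φ≡αg
    φ∈ : ∀ x → K x → K (φ x)
    φ∈ x Kx = subst K (sym (φ≡αg x Kx)) (·∈ (α∈ x Kx) Kg)
    φ-surj : ∀ y → K y → ∃ λ x → K x × φ x ≡ y
    φ-surj y Ky with α-surj (y · g ⁻¹) (·∈ Ky (⁻¹∈ Kg))
    ... | x , Kx , αx≡yg⁻¹ =
      x , Kx , trans (φ≡αg x Kx) (trans (cong (_· g) αx≡yg⁻¹) (//-rightDividesˡ g y))
    Joined⇔ : ∀ {c u v} → S c ⊎ S (c ⁻¹) → K u → K v → Joined c u v ⇔ Joined c (φ u) (φ v)
    Joined⇔ col with colour⇒Signed (λ {s} → α-±1 s) col
    ... | Kc , ±c = Joined⇔Joined-φ α-inj Kc ±c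

  -- Factorisations G = H K
  module Decomposition {H K : Carrier → Set} (K-closed : ClosedUnderGroupOps K)
                       (H-closed : ClosedUnderGroupOps H) (H∩K : ∀ {x} → H x → K x → x ≡ e)
                       (G≡HK : ∀ g → Prod G H K g) where
    private
      module H = ClosedUnderGroupOps H-closed
      module K = ClosedUnderGroupOps K-closed

    H-part K-part : Carrier → Carrier
    H-part g = proj₁ (G≡HK g)
    K-part g = proj₁ (proj₂ (G≡HK g))

    H-part∈H : ∀ g → H (H-part g)
    H-part∈H g = proj₁ (proj₂ (proj₂ (G≡HK g)))

    K-part∈K : ∀ g → K (K-part g)
    K-part∈K g = proj₁ (proj₂ (proj₂ (proj₂ (G≡HK g))))

    decompose : ∀ g → g ≡ H-part g · K-part g
    decompose g = proj₂ (proj₂ (proj₂ (proj₂ (G≡HK g))))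

    decomposition-unique : ∀ {h₁ h₂ x₁ x₂} → H h₁ → H h₂ → K x₁ → K x₂ →
                           h₁ · x₁ ≡ h₂ · x₂ → h₁ ≡ h₂ × x₁ ≡ x₂
    decomposition-unique {h₁} {h₂} {x₁} {x₂} Hh₁ Hh₂ Kx₁ Kx₂ h₁x₁≡h₂x₂ =
      h₁≡h₂ , ∙-cancelˡ h₁ x₁ x₂ (trans h₁x₁≡h₂x₂ (cong (_· x₂) (sym h₁≡h₂)))
      where
      quotients≡ : h₂ ⁻¹ · h₁ ≡ x₂ · x₁ ⁻¹
      quotients≡ = begin
        h₂ ⁻¹ · h₁                  ≡⟨ //-rightDividesʳ x₁ _ ⟨
        h₂ ⁻¹ · h₁ · x₁ · x₁ ⁻¹     ≡⟨ cong (_· x₁ ⁻¹) (assoc (h₂ ⁻¹) h₁ x₁) ⟩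
        h₂ ⁻¹ · (h₁ · x₁) · x₁ ⁻¹   ≡⟨ cong (λ w → h₂ ⁻¹ · w · x₁ ⁻¹) h₁x₁≡h₂x₂ ⟩
        h₂ ⁻¹ · (h₂ · x₂) · x₁ ⁻¹   ≡⟨ cong (_· x₁ ⁻¹) (\\-leftDividesʳ h₂ x₂) ⟩
        x₂ · x₁ ⁻¹                  ∎
      h₁≡h₂ : h₁ ≡ h₂
      h₁≡h₂ = trans (inverseʳ-unique (h₂ ⁻¹) h₁ (H∩K (H.·∈ (H.⁻¹∈ Hh₂) Hh₁)
                (subst K (sym quotients≡) (K.·∈ Kx₂ (K.⁻¹∈ Kx₁))))) (⁻¹-involutive h₂)

    parts-of-· : ∀ {h x} → H h → K x → H-part (h · x) ≡ h × K-part (h · x) ≡ x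
    parts-of-· {h} {x} Hh Kx =
      decomposition-unique (H-part∈H _) Hh (K-part∈K _) Kx (sym (decompose (h · x)))

    extend : (Carrier → Carrier) → Carrier → Carrier
    extend χ g = H-part g · χ (K-part g)

    extend-· : ∀ χ {h x} → H h → K x → extend χ (h · x) ≡ h · χ x
    extend-· χ Hh Kx with parts-of-· Hh Kx
    ... | H-part≡h , K-part≡x = cong₂ (λ h' x' → h' · χ x') H-part≡h K-part≡x

    extend-on-K : ∀ χ {x} → K x → extend χ x ≡ χ x
    extend-on-K χ {x} Kx = begin
      extend χ x        ≡⟨ cong (extend χ) (identityˡ x) ⟨
      extend χ (e · x)  ≡⟨ extend-· χ H.e∈ Kx ⟩
      e · χ x           ≡⟨ identityˡ (χ x) ⟩
      χ x               ∎

    extend-inverse : ∀ {χ θ} → (∀ {x} → K x → K (θ x)) → (∀ {x} → K x → χ (θ x) ≡ x) →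
                     ∀ g → extend χ (extend θ g) ≡ g
    extend-inverse {χ} {θ} θ∈K χθ≡id g = begin
      extend χ (H-part g · θ (K-part g))  ≡⟨ extend-· χ (H-part∈H g) (θ∈K (K-part∈K g)) ⟩
      H-part g · χ (θ (K-part g))         ≡⟨ cong (H-part g ·_) (χθ≡id (K-part∈K g)) ⟩
      H-part g · K-part g                 ≡⟨ decompose g ⟨
      g                                   ∎

    K-part-on-K : ∀ {x} → K x → K-part x ≡ x
    K-part-on-K {x} Kx = trans (cong K-part (sym (identityˡ x))) (proj₂ (parts-of-· H.e∈ Kx))

    module _ {φ : Carrier → Carrier} (φ-bij : BijOn G K φ) where

      section : Carrier → Carrier
      section g = proj₁ (proj₂ (proj₂ φ-bij) (K-part g) (K-part∈K g))

      section∈K : ∀ {g} → K (section g)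
      section∈K {g} = proj₁ (proj₂ (proj₂ (proj₂ φ-bij) (K-part g) (K-part∈K g)))

      φ-section : ∀ {x} → K x → φ (section x) ≡ x
      φ-section {x} Kx = trans (proj₂ (proj₂ (proj₂ (proj₂ φ-bij) (K-part x) (K-part∈K x)))) (K-part-on-K Kx)

      section-φ : ∀ {x} → K x → section (φ x) ≡ x
      section-φ {x} Kx =
        proj₁ (proj₂ φ-bij) _ _ section∈K Kx (φ-section (proj₁ φ-bij x Kx))

  -- From Cay(F R, S′) to Cay(G, S)
  module CayleyExtension
    {F H R : Carrier → Set} (sF : IsSubgroup G F) (sH : IsSubgroup G H) (sR : IsSubgroup G R)
    (nF : IsNormal G F) (nH : IsNormal G H)
    (F∩H : ∀ x → F x → H x → x ≡ e) (FH∩R : ∀ x → Prod G F H x → R x → x ≡ e)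
    (G≡FHR : ∀ g → Prod G (Prod G F H) R g)
    {r : Carrier} (Rr : R r) (R≡⟨r⟩ : ∀ x → R x → ∃ λ n → x ≡ pow G r n) (r²≡e : r · r ≡ e)
    {S : Carrier → Set} (S⁻¹ : ∀ s → S s → S (s ⁻¹))
    where
    private
      module F = IsSubgroup sF
      module H = IsSubgroup sH
      module R = IsSubgroup sR

    FR : Carrier → Set
    FR = Prod G F R

    Y : Carrier → Set
    Y s = S s × ¬ (F s ⊎ Prod G H R s)

    S' : Carrier → Set
    S' x = (F x × S x) ⊎ (x ≡ r) ⊎ (∃ λ y → Y y × x ≡ y · y)

    F-H-commute : ∀ {f h} → F f → H h → f · h ≡ h · f
    F-H-commute = disjoint-normal-commute sF sH nF nH F∩H

    F-H-swap : ∀ {f h} → F f → H h → ∀ w → f · (h · w) ≡ h · (f · w)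
    F-H-swap {f} {h} Ff Hh w = begin
      f · (h · w)  ≡⟨ assoc f h w ⟨
      f · h · w    ≡⟨ cong (_· w) (F-H-commute Ff Hh) ⟩
      h · f · w    ≡⟨ assoc h f w ⟩
      h · (f · w)  ∎

    FR-closed : ClosedUnderGroupOps FR
    FR-closed = normal·subgroup-closed sF nF sR
    open ClosedUnderGroupOps FR-closed

    F⊆FR : ∀ {x} → F x → FR x
    F⊆FR {x} Fx = x , e , Fx , R.e∈ , sym (identityʳ x)

    R⊆FR : ∀ {x} → R x → FR x
    R⊆FR {x} Rx = e , x , F.e∈ , Rx , sym (identityˡ x)

    H∩FR : ∀ {t} → H t → FR t → t ≡ e
    H∩FR {t} Ht (a , ρ , Fa , Rρ , refl) = begin
      a · ρ  ≡⟨ cong (a ·_) ρ≡e ⟩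
      a · e  ≡⟨ identityʳ a ⟩
      a      ≡⟨ F∩H a Fa (subst H (trans (cong (a ·_) ρ≡e) (identityʳ a)) Ht) ⟩
      e      ∎
      where
      ρ≡e : ρ ≡ e
      ρ≡e = FH∩R ρ (a ⁻¹ , a · ρ , F.⁻¹∈ Fa , Ht , sym (\\-leftDividesʳ a ρ)) Rρ

    G≡H·FR : ∀ g → Prod G H FR g
    G≡H·FR g with G≡FHR g
    ... | _ , ρ , (f , h , Ff , Hh , refl) , Rρ , refl =
      h , f · ρ , Hh , (f , ρ , Ff , Rρ , refl) , trans (cong (_· ρ) (F-H-commute Ff Hh)) (assoc h f ρ)

    open Decomposition FR-closed (IsSubgroup⇒Closed sH) H∩FR G≡H·FR public

    F∪HR? : ∀ c → Dec (F c ⊎ Prod G H R c)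
    F∪HR? c with F.dec c | R.dec (K-part c)
    ... | yes Fc | _           = yes (inj₁ Fc)
    ... | no ¬Fc | yes R[c]    = yes (inj₂ (H-part c , K-part c , H-part∈H c , R[c] , decompose c))
    ... | no ¬Fc | no ¬R[c]    = no λ
      { (inj₁ Fc) → ¬Fc Fc
      ; (inj₂ (a , ρ , Ha , Rρ , c≡aρ)) →
          ¬R[c] (subst R (sym (trans (cong K-part c≡aρ) (proj₂ (parts-of-· Ha (R⊆FR Rρ))))) Rρ) }

    module YAlgebra {f a : Carrier} (Ff : F f) (Ha : H a) (fr≡rf : f · r ≡ r · f) (f³≡e : f · f · f ≡ e)
                    (z²≡e : a · r · (a · r) ≡ e) where
      z c : Carrier
      z = a · r
      c = f · z

      τ : Carrier → Carrier
      τ h = a · (r · h · r ⁻¹)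

      τ∈H : ∀ {h} → H h → H (τ h)
      τ∈H Hh = H.·∈ Ha (nH r _ Hh)

      c-action : ∀ {h} → H h → ∀ y → c · (h · y) ≡ τ h · (f · (r · y))
      c-action {h} Hh y = begin
        f · z · (h · y)        ≡⟨ assoc f z _ ⟩
        f · (z · (h · y))      ≡⟨ cong (f ·_) (conj-shift a r h y) ⟨
        f · (τ h · (r · y))    ≡⟨ F-H-swap Ff (τ∈H Hh) (r · y) ⟩
        τ h · (f · (r · y))    ∎

      fz≡zf : f · z ≡ z · f
      fz≡zf = begin
        f · (a · r)  ≡⟨ assoc f a r ⟨
        f · a · r    ≡⟨ cong (_· r) (F-H-commute Ff Ha) ⟩
        a · f · r    ≡⟨ assoc a f r ⟩
        a · (f · r)  ≡⟨ cong (a ·_) fr≡rf ⟩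
        a · (r · f)  ≡⟨ assoc a r f ⟨
        a · r · f    ∎

      c²≡f² : c · c ≡ f · f
      c²≡f² = begin
        f · z · (f · z)    ≡⟨ assoc f z _ ⟩
        f · (z · (f · z))  ≡⟨ cong (λ w → f · (z · w)) fz≡zf ⟩
        f · (z · (z · f))  ≡⟨ cong (f ·_) (assoc z z f) ⟨
        f · (z · z · f)    ≡⟨ cong (λ w → f · (w · f)) z²≡e ⟩
        f · (e · f)        ≡⟨ cong (f ·_) (identityˡ f) ⟩
        f · f              ∎

      f²-f : ∀ w → f · f · (f · w) ≡ w
      f²-f w = begin
        f · f · (f · w)  ≡⟨ assoc (f · f) f w ⟨
        f · f · f · w    ≡⟨ cong (_· w) f³≡e ⟩
        e · w            ≡⟨ identityˡ w ⟩
        w                ∎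

      f-f² : ∀ w → f · (f · f · w) ≡ w
      f-f² w = begin
        f · (f · f · w)    ≡⟨ assoc f (f · f) w ⟨
        f · (f · f) · w    ≡⟨ cong (_· w) (assoc f f f) ⟨
        f · f · f · w      ≡⟨ cong (_· w) f³≡e ⟩
        e · w              ≡⟨ identityˡ w ⟩
        w                  ∎

      f²-r : ∀ w → f · f · (r · w) ≡ f · (r · (f · w))
      f²-r w = begin
        f · f · (r · w)    ≡⟨ assoc f f _ ⟩
        f · (f · (r · w))  ≡⟨ cong (f ·_) (assoc f r w) ⟨
        f · (f · r · w)    ≡⟨ cong (λ v → f · (v · w)) fr≡rf ⟩
        f · (r · f · w)    ≡⟨ cong (f ·_) (assoc r f w) ⟩
        f · (r · (f · w))  ∎

    pow∈R : ∀ n → R (pow G r n)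
    pow∈R zero    = R.e∈
    pow∈R (suc n) = R.·∈ Rr (pow∈R n)

    module Extension {χ : Carrier → Carrier} (χ-arcs : PreservesArcs FR S' χ) where

      χ-r : ∀ {x} → FR x → χ (r · x) ≡ r · χ x
      χ-r FRx = Joined-involution r²≡e (χ-arcs (inj₂ (inj₁ refl)) FRx)

      χ-pow : ∀ n {x} → FR x → χ (pow G r n · x) ≡ pow G r n · χ x
      χ-pow zero    {x} FRx = trans (cong χ (identityˡ x)) (sym (identityˡ (χ x)))
      χ-pow (suc n) {x} FRx = begin
        χ (r · P · x)    ≡⟨ cong χ (assoc r P x) ⟩
        χ (r · (P · x))  ≡⟨ χ-r (·∈ (R⊆FR (pow∈R n)) FRx) ⟩
        r · χ (P · x)    ≡⟨ cong (r ·_) (χ-pow n FRx) ⟩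
        r · (P · χ x)    ≡⟨ assoc r P (χ x) ⟨
        r · P · χ x      ∎
        where
        P : Carrier
        P = pow G r n

      χ-R : ∀ {ρ x} → R ρ → FR x → χ (ρ · x) ≡ ρ · χ x
      χ-R {ρ} Rρ FRx with R≡⟨r⟩ ρ Rρ
      ... | n , refl = χ-pow n FRx

      extend-arc-F : ∀ {c h x} → F c → S c → H h → FR x → Joined c (h · χ x) (extend χ (c · (h · x)))
      extend-arc-F {c} {h} {x} Fc Sc Hh FRx =
        subst (Joined c (h · χ x)) (sym extend≡) (Joined-·ˡ (F-H-swap Fc Hh) (χ-arcs (inj₁ (Fc , Sc)) FRx))
        where
        extend≡ : extend χ (c · (h · x)) ≡ h · χ (c · x)
        extend≡ = trans (cong (extend χ) (F-H-swap Fc Hh x)) (extend-· χ Hh (·∈ (F⊆FR Fc) FRx))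

      extend-arc-HR : ∀ {c h x} → Prod G H R c → H h → FR x → Joined c (h · χ x) (extend χ (c · (h · x)))
      extend-arc-HR {h = h} {x} (a , ρ , Ha , Rρ , refl) Hh FRx = inj₁ (begin
        extend χ (a · ρ · (h · x))                  ≡⟨ cong (extend χ) (conj-shift a ρ h x) ⟨
        extend χ (a · (ρ · h · ρ ⁻¹) · (ρ · x))     ≡⟨ extend-· χ (H.·∈ Ha (nH ρ h Hh)) (·∈ (R⊆FR Rρ) FRx) ⟩
        a · (ρ · h · ρ ⁻¹) · χ (ρ · x)              ≡⟨ cong (a · (ρ · h · ρ ⁻¹) ·_) (χ-R Rρ FRx) ⟩
        a · (ρ · h · ρ ⁻¹) · (ρ · χ x)              ≡⟨ conj-shift a ρ h (χ x) ⟩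
        a · ρ · (h · χ x)                           ∎)

      module _ {f a : Carrier} (Ff : F f) (Ha : H a) (fr≡rf : f · r ≡ r · f) (f³≡e : f · f · f ≡ e)
               (z²≡e : a · r · (a · r) ≡ e) where
        open YAlgebra Ff Ha fr≡rf f³≡e z²≡e

        -- The arc of colour c² = f² from t = f r x lands on r x, where χ is known to commute with r.
        extend-arc-Y : ∀ {h x} → Y c → H h → FR x → Joined c (h · χ x) (extend χ (c · (h · x)))
        extend-arc-Y {h} {x} Yc Hh FRx = by-cases (χ-arcs (inj₂ (inj₂ (c , Yc , refl))) FR[t])
          where
          t : Carrier
          t = f · (r · x)
          FR[t] : FR t
          FR[t] = ·∈ (F⊆FR Ff) (·∈ (R⊆FR Rr) FRx)
          extend-c·hx : extend χ (c · (h · x)) ≡ τ h · χ t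
          extend-c·hx = trans (cong (extend χ) (c-action Hh x)) (extend-· χ (τ∈H Hh) FR[t])
          χc²t≡rχx : χ (c · c · t) ≡ r · χ x
          χc²t≡rχx = trans (cong χ (trans (cong (_· t) c²≡f²) (f²-f (r · x)))) (χ-r FRx)

          by-cases : Joined (c · c) (χ t) (χ (c · c · t)) → Joined c (h · χ x) (extend χ (c · (h · x)))
          by-cases (inj₁ χc²t≡c²χt) = inj₁ (begin
            extend χ (c · (h · x))   ≡⟨ extend-c·hx ⟩
            τ h · χ t                ≡⟨ cong (τ h ·_) χt≡frχx ⟩
            τ h · (f · (r · χ x))    ≡⟨ c-action Hh (χ x) ⟨
            c · (h · χ x)            ∎)
            where
            χt≡frχx : χ t ≡ f · (r · χ x)
            χt≡frχx = begin
              χ t                  ≡⟨ f-f² (χ t) ⟨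
              f · (f · f · χ t)    ≡⟨ cong (λ w → f · (w · χ t)) c²≡f² ⟨
              f · (c · c · χ t)    ≡⟨ cong (f ·_) χc²t≡c²χt ⟨
              f · χ (c · c · t)    ≡⟨ cong (f ·_) χc²t≡rχx ⟩
              f · (r · χ x)        ∎
          by-cases (inj₂ χt≡c²χc²t) = inj₂ (sym (begin
            c · extend χ (c · (h · x))           ≡⟨ cong (c ·_) extend-c·hx ⟩
            c · (τ h · χ t)                      ≡⟨ cong (λ w → c · (τ h · w)) χt≡f²rχx ⟩
            c · (τ h · (f · f · (r · χ x)))      ≡⟨ cong (λ w → c · (τ h · w)) (f²-r (χ x)) ⟩
            c · (τ h · (f · (r · (f · χ x))))    ≡⟨ cong (c ·_) (c-action Hh (f · χ x)) ⟨
            c · (c · (h · (f · χ x)))            ≡⟨ assoc c c _ ⟨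
            c · c · (h · (f · χ x))              ≡⟨ cong (_· (h · (f · χ x))) c²≡f² ⟩
            f · f · (h · (f · χ x))              ≡⟨ F-H-swap (F.·∈ Ff Ff) Hh (f · χ x) ⟩
            h · (f · f · (f · χ x))              ≡⟨ cong (h ·_) (f²-f (χ x)) ⟩
            h · χ x                              ∎))
            where
            χt≡f²rχx : χ t ≡ f · f · (r · χ x)
            χt≡f²rχx = trans χt≡c²χc²t (cong₂ _·_ c²≡f² χc²t≡rχx)

    module _ (Y-shape : ∀ y → Y y → ∃₂ λ f z → F f × Prod G H (λ x → x ≡ r) z
                                   × HasOrder G f 3 × HasOrder G z 2 × y ≡ f · z)
             (Y-cond : (∃ λ y → Y y) → card G sR ≡ 2 × (∀ f x → F f → R x → f · x ≡ x · f)) where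

      Y-form : ∀ {y} → Y y → ∃₂ λ f a → F f × H a × f · r ≡ r · f × f · f · f ≡ e
                                     × a · r · (a · r) ≡ e × y ≡ f · (a · r)
      Y-form Yy with Y-shape _ Yy
      ... | f , _ , Ff , (a , _ , Ha , refl , refl) , (_ , f³≡e , _) , (_ , z²≡e , _) , refl =
        f , a , Ff , Ha , proj₂ (Y-cond (_ , Yy)) f r Ff Rr ,
        trans (assoc f f f) (trans (cong (λ w → f · (f · w)) (sym (identityʳ f))) f³≡e) ,
        trans (cong (a · r ·_) (sym (identityʳ (a · r)))) z²≡e , refl

      Y-square∈F : ∀ {y} → Y y → F (y · y)
      Y-square∈F Yy with Y-form Yy
      ... | f , a , Ff , Ha , fr≡rf , f³≡e , z²≡e , refl =
        subst F (sym (YAlgebra.c²≡f² Ff Ha fr≡rf f³≡e z²≡e)) (F.·∈ Ff Ff)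

      S'⊆FR : ∀ {x} → S' x → FR x
      S'⊆FR (inj₁ (Fx , _))              = F⊆FR Fx
      S'⊆FR (inj₂ (inj₁ refl))           = R⊆FR Rr
      S'⊆FR (inj₂ (inj₂ (_ , Yy , refl))) = F⊆FR (Y-square∈F Yy)

      extend-arc : ∀ {χ} → PreservesArcs FR S' χ → ∀ {c h x} → S c → H h → FR x →
                   Joined c (h · χ x) (extend χ (c · (h · x)))
      extend-arc χ-arcs {c} Sc with F∪HR? c
      ... | yes (inj₁ Fc)  = Extension.extend-arc-F χ-arcs Fc Sc
      ... | yes (inj₂ HRc) = Extension.extend-arc-HR χ-arcs HRc
      ... | no ¬F∪HR with Y-form (Sc , ¬F∪HR)
      ...   | f , a , Ff , Ha , fr≡rf , f³≡e , z²≡e , refl =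
        Extension.extend-arc-Y χ-arcs Ff Ha fr≡rf f³≡e z²≡e (Sc , ¬F∪HR)

      extend-PreservesArcs : ∀ {χ} → PreservesArcs FR S' χ → PreservesArcs (λ _ → ⊤) S (extend χ)
      extend-PreservesArcs {χ} χ-arcs {c} {u} Sc _ =
        subst (λ w → Joined c (extend χ u) (extend χ (c · w))) (sym (decompose u))
          (extend-arc χ-arcs Sc (H-part∈H u) (K-part∈K u))

      extend-ColAut : ∀ {φ} → ColAut G FR S' φ → ColAut G (λ _ → ⊤) S (extend φ)
      extend-ColAut {φ} col@(φ-bij , _) =
        inverses⇒ColAut S⁻¹
          (extend-inverse {section φ-bij} {φ} (λ {x} → proj₁ φ-bij x) (section-φ φ-bij))
          (extend-inverse {φ} {section φ-bij} (λ _ → section∈K φ-bij) (φ-section φ-bij))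
          (extend-PreservesArcs (ColAut⇒PreservesArcs FR-closed S'⊆FR col))
          (extend-PreservesArcs
            (ColAut⇒section-PreservesArcs FR-closed S'⊆FR col (λ _ → section∈K φ-bij) (φ-section φ-bij)))

      IsCCA-restricts : IsCCA G (λ _ → ⊤) S → IsCCA G FR S'
      IsCCA-restricts (ColAut⇒InRegAut-G , _) =
        (λ φ col → restrict col (ColAut⇒InRegAut-G (extend φ) (extend-ColAut col))) ,
        (λ _ → InRegAut⇒ColAut FR-closed S'⊆FR)
        where
        restrict : ∀ {φ} → ColAut G FR S' φ → InRegAut G (λ _ → ⊤) S (extend φ) → InRegAut G FR S' φ
        restrict {φ} col (α , g , ((_ , α-inj , _) , α-hom , _) , _ , extend≡αg) =
          Affine.ColAut⇒InRegAut FR-closed S'⊆FR (λ x y _ _ → α-hom x y tt tt)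
            (λ x FRx → trans (sym (extend-on-K φ FRx)) (extend≡αg x tt))
            (λ x y _ _ → α-inj x y tt tt) col

proposition5p3 :
    (G : FinGroup) → let open FinGroup G in
    SylowCyclic G → ¬ (4 ∣ order G) →
    (F H R : Carrier → Set) (sF : IsSubgroup G F) (sH : IsSubgroup G H) (sR : IsSubgroup G R) →
    IsNormal G F → IsNormal G H →
    (∀ x → F x → H x → x ≡ e) →
    (∀ x → Prod G F H x → R x → x ≡ e) →
    (∀ g → Prod G (Prod G F H) R g) →
    IsoF21 G F →
    IsSylow G 2 R sR →
    (r : Carrier) → R r → (∀ x → R x → ∃ λ n → x ≡ pow G r n) →
    (S : Carrier → Set) → (∀ s → S s → S (s ⁻¹)) → (∀ x → Gen G S x) →
    let Y  = λ s → S s × ¬ (F s ⊎ Prod G H R s)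
        S' = λ x → (F x × S x) ⊎ (x ≡ r) ⊎ (∃ λ y → Y y × x ≡ y · y)
        FR = Prod G F R
    in
    (Connected G FR S' × ¬ IsCCA G FR S') →
    (∀ y → Y y → ∃₂ λ f z → F f × Prod G H (λ x → x ≡ r) z
                          × HasOrder G f 3 × HasOrder G z 2 × y ≡ f · z) →
    ((∃ λ y → Y y) → card G sR ≡ 2 × (∀ f x → F f → R x → f · x ≡ x · f)) →
    Connected G (λ _ → ⊤) S × ¬ IsCCA G (λ _ → ⊤) S
proposition5p3 G _ 4∤|G| F H R sF sH sR nF nH F∩H FH∩R G≡FHR _ sylR r Rr R≡⟨r⟩
               S S⁻¹ S-generates (_ , Γ′-non-CCA) Y-shape Y-cond =
  (λ x _ → Gen⇒Reach G S⁻¹ (S-generates x)) ,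
  λ Γ-CCA → Γ′-non-CCA (IsCCA-restricts Y-shape Y-cond Γ-CCA)
  where
  open CayleyExtension G sF sH sR nF nH F∩H FH∩R G≡FHR Rr R≡⟨r⟩
         (square≡e-in-Sylow₂ G sR sylR 4∤|G| Rr) S⁻¹
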